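{- For every integer $k \geq 1$, let $b(k)$ denote the greatest common divisor of all the integers $\sum_{i=1}^{k} b_{n+i}$ for $n \geq 0$. Then $$b(k) = \begin{cases} \gcd\!\left(\tfrac{1}{2}(B_k - k),\, P_k\right), & \text{if } k \text{ is even};\\ \gcd\!\left(\tfrac{1}{2}(B_k - k),\, 2Q_k\right), & \text{if } k \text{ is odd}.\end{cases}$$
   Context: The cobalancing sequence $(b_n)_{n\ge 0}$: $b_0=0$, $b_1=0$, $b_n=6b_{n-1}-b_{n-2}+2$ for $n\ge 2$. The balancing sequence $(B_n)_{n\ge 0}$: $B_0=0$, $B_1=1$, $B_n=6B_{n-1}-B_{n-2}$. The Pell sequence $(P_n)_{n\ge 0}$: $P_0=0$, $P_1=1$, $P_n=2P_{n-1}+P_{n-2}$. The associated Pell sequence $(Q_n)_{n\ge 0}$: $Q_0=1$, $Q_1=1$, $Q_n=2Q_{n-1}+Q_{n-2}$. -}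

module Defs where

open import Data.Nat using (ℕ; zero; suc; _+_; _*_; _∸_)
open import Data.Nat.Divisibility using (_∣_)
open import Data.Product using (_×_)

-- cobalancing numbers b_n (all values are naturals; the subtraction is exact
-- because the sequence is nondecreasing)
cob : ℕ → ℕ
cob zero = 0
cob (suc zero) = 0
cob (suc (suc n)) = (6 * cob (suc n) ∸ cob n) + 2

-- balancing numbers B_n (subtraction exact: sequence increasing)
bal : ℕ → ℕ
bal zero = 0
bal (suc zero) = 1
bal (suc (suc n)) = 6 * bal (suc n) ∸ bal n

pell : ℕ → ℕ
pell zero = 0
pell (suc zero) = 1
pell (suc (suc n)) = 2 * pell (suc n) + pell n

qpell : ℕ → ℕ
qpell zero = 1
qpell (suc zero) = 1
qpell (suc (suc n)) = 2 * qpell (suc n) + qpell n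

windowSum : ℕ → ℕ → ℕ
windowSum zero n = 0
windowSum (suc k) n = windowSum k n + cob (n + suc k)

IsGcdOf : (ℕ → ℕ) → ℕ → Set
IsGcdOf f d = (∀ n → d ∣ f n) × (∀ e → (∀ n → e ∣ f n) → e ∣ d)

-- With P(n+1) = P n + Q n and Q(n+1) = Q n + 2 P n one has B n = P n Q n and
-- Q n² − 2 P n² = (−1)ⁿ. Since 2 b(n+1) = B(n+1) − B n − 1, the window sums S n
-- telescope to 2 S n = B(n+k) − B n − k, and they satisfy
-- S(n+2) + S n = 6 S(n+1) + 2k, so their gcd is gcd(S 0, S 1, 2k).
-- Put x = S 0 = (B k − k)/2. For even k, S 1 = x + P(2P+Q), and a common divisor
-- of x and 2k is coprime to 2P+Q; for odd k, S 1 = x + Q(P+Q) with P+Q even, and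
-- a common divisor of x and 2k shares at most the factor 2 with P+Q. Either way
-- the common divisors of S 0, S 1, 2k are those of x and P, resp. of x and 2Q.
module Submission where

open import Defs
open import Data.Nat using (ℕ; zero; suc; _+_; _*_; _∸_; _≤_; _/_; _%_; z≤n; s≤s)
open import Data.Nat.GCD using (gcd; gcd-greatest; gcd[m,n]∣m; gcd[m,n]∣n; c*gcd[m,n]≡gcd[cm,cn])
open import Data.Nat.Properties
open import Data.Nat.Divisibility
open import Data.Nat.DivMod using (m≡m%n+[m/n]*n; m*n/n≡m)
open import Data.Nat.Tactic.RingSolver using (solve-∀)
open import Data.Product using (_×_; _,_; proj₁; proj₂)
open import Relation.Binary.PropositionalEquality

+-cancelʳ-≡-by : ∀ {l r x y : ℕ} → x ≡ y → l + x ≡ r + y → l ≡ r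
+-cancelʳ-≡-by {l} {r} {x} {y} x≡y eq = +-cancelʳ-≡ y l r (trans (cong (l +_) (sym x≡y)) eq)

n%2≡r-elim : ∀ (C : ℕ → Set) {n r} → n % 2 ≡ r → (∀ m → C (r + m * 2)) → C n
n%2≡r-elim C {n} refl c = subst C (sym (m≡m%n+[m/n]*n n 2)) (c (n / 2))

[m∸n]/2≡x : ∀ {x n m} → 2 * x + n ≡ m → (m ∸ n) / 2 ≡ x
[m∸n]/2≡x {x} {n} refl = begin
  (2 * x + n ∸ n) / 2 ≡⟨ cong (_/ 2) (m+n∸n≡m (2 * x) n) ⟩
  2 * x / 2           ≡⟨ cong (_/ 2) (*-comm 2 x) ⟩
  x * 2 / 2           ≡⟨ m*n/n≡m x 2 ⟩
  x                   ∎
  where open ≡-Reasoning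

∣m*n⇒∣m*gcd[d,n] : ∀ {d} m {n} → d ∣ m * n → d ∣ m * gcd d n
∣m*n⇒∣m*gcd[d,n] {d} m {n} d∣mn =
  subst (d ∣_) (sym (c*gcd[m,n]≡gcd[cm,cn] m d n)) (gcd-greatest (n∣m*n m) d∣mn)

Recurrent : ℕ → ℕ → (ℕ → ℕ) → Set
Recurrent a c f = ∀ n → f (2 + n) + f n ≡ a * f (1 + n) + c

recurrent-unique : ∀ {a c f g} → Recurrent a c f → Recurrent a c g →
                   f 0 ≡ g 0 → f 1 ≡ g 1 → ∀ n → f n ≡ g n
recurrent-unique {a} {c} {f} {g} rec-f rec-g f₀≡g₀ f₁≡g₁ n = proj₁ (agree n)
  where
  open ≡-Reasoning
  agree : ∀ n → f n ≡ g n × f (1 + n) ≡ g (1 + n)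
  agree zero = f₀≡g₀ , f₁≡g₁
  agree (suc n) with agree n
  ... | fₙ≡gₙ , fₙ₊₁≡gₙ₊₁ = fₙ₊₁≡gₙ₊₁ , +-cancelʳ-≡-by fₙ≡gₙ (begin
    f (2 + n) + f n   ≡⟨ rec-f n ⟩
    a * f (1 + n) + c ≡⟨ cong (λ v → a * v + c) fₙ₊₁≡gₙ₊₁ ⟩
    a * g (1 + n) + c ≡⟨ rec-g n ⟨
    g (2 + n) + g n   ∎)

n≤a*n∸m : ∀ {a m n} → 2 ≤ a → m ≤ n → n ≤ a * n ∸ m
n≤a*n∸m {a} {m} {n} 2≤a m≤n = begin
  n         ≡⟨ sym (m+n∸m≡n n n) ⟩
  n + n ∸ n ≤⟨ ∸-monoˡ-≤ n n+n≤a*n ⟩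
  a * n ∸ n ≤⟨ ∸-monoʳ-≤ (a * n) m≤n ⟩
  a * n ∸ m ∎
  where
  open ≤-Reasoning
  n+n≤a*n : n + n ≤ a * n
  n+n≤a*n = ≤-trans (≤-reflexive (cong (n +_) (sym (+-identityʳ n)))) (*-monoˡ-≤ n 2≤a)

-- Monotonicity makes the truncated subtraction in step exact.
module SubtractiveRecurrence {a c : ℕ} {f : ℕ → ℕ} (2≤a : 2 ≤ a) (f₀≤f₁ : f 0 ≤ f 1)
  (step : ∀ n → f (2 + n) ≡ a * f (1 + n) ∸ f n + c) where

  monotone : ∀ n → f n ≤ f (1 + n)
  monotone zero = f₀≤f₁
  monotone (suc n) = begin
    f (1 + n)               ≤⟨ n≤a*n∸m 2≤a (monotone n) ⟩
    a * f (1 + n) ∸ f n     ≤⟨ m≤m+n _ c ⟩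
    a * f (1 + n) ∸ f n + c ≡⟨ step n ⟨
    f (2 + n)               ∎
    where open ≤-Reasoning

  recurrent : Recurrent a c f
  recurrent n = begin
    f (2 + n) + f n               ≡⟨ cong (_+ f n) (trans (step n) (sym (+-∸-comm c fₙ≤))) ⟩
    a * f (1 + n) + c ∸ f n + f n ≡⟨ m∸n+n≡m (m≤n⇒m≤n+o c fₙ≤) ⟩
    a * f (1 + n) + c             ∎
    where
    open ≡-Reasoning
    fₙ≤ : f n ≤ a * f (1 + n)
    fₙ≤ = ≤-trans (≤-trans (monotone n) (n≤a*n∸m 2≤a (monotone n))) (m∸n≤m _ (f n))

pell-qpell-suc : ∀ n → pell (suc n) ≡ pell n + qpell n × qpell (suc n) ≡ qpell n + 2 * pell n
pell-qpell-suc zero = refl , refl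
pell-qpell-suc (suc n) with pell-qpell-suc n
... | pₙ₊₁≡ , qₙ₊₁≡ = pell-step , qpell-step
  where
  pell-step : 2 * pell (suc n) + pell n ≡ pell (suc n) + qpell (suc n)
  pell-step rewrite pₙ₊₁≡ | qₙ₊₁≡ = identity (pell n) (qpell n)
    where
    identity : ∀ p q → 2 * (p + q) + p ≡ (p + q) + (q + 2 * p)
    identity = solve-∀
  qpell-step : 2 * qpell (suc n) + qpell n ≡ qpell (suc n) + 2 * pell (suc n)
  qpell-step rewrite pₙ₊₁≡ | qₙ₊₁≡ = identity (pell n) (qpell n)
    where
    identity : ∀ p q → 2 * (q + 2 * p) + q ≡ (q + 2 * p) + 2 * (p + q)
    identity = solve-∀

pell-suc : ∀ n → pell (suc n) ≡ pell n + qpell n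
pell-suc n = proj₁ (pell-qpell-suc n)

qpell-suc : ∀ n → qpell (suc n) ≡ qpell n + 2 * pell n
qpell-suc n = proj₂ (pell-qpell-suc n)

qpell²+qpell²≡2pell²+2pell² : ∀ n → qpell (suc n) * qpell (suc n) + qpell n * qpell n
                                  ≡ 2 * (pell (suc n) * pell (suc n)) + 2 * (pell n * pell n)
qpell²+qpell²≡2pell²+2pell² n rewrite pell-suc n | qpell-suc n = identity (pell n) (qpell n)
  where
  identity : ∀ p q → (q + 2 * p) * (q + 2 * p) + q * q ≡ 2 * ((p + q) * (p + q)) + 2 * (p * p)
  identity = solve-∀

-- Without subtraction: q − p = 1 and q' − p' = −(q − p) give q' − p' = −1, and vice versa.
sign-flip⁺ : ∀ {q' q p' p} → q' + q ≡ p' + p → q ≡ p + 1 → q' + 1 ≡ p'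
sign-flip⁺ {q'} {q} {p'} {p} sum q≡p+1 = +-cancelʳ-≡ p (q' + 1) p' (begin
  q' + 1 + p   ≡⟨ +-assoc q' 1 p ⟩
  q' + (1 + p) ≡⟨ cong (q' +_) (trans (+-comm 1 p) (sym q≡p+1)) ⟩
  q' + q       ≡⟨ sum ⟩
  p' + p       ∎)
  where open ≡-Reasoning

sign-flip⁻ : ∀ {q' q p' p} → q' + q ≡ p' + p → q + 1 ≡ p → q' ≡ p' + 1
sign-flip⁻ {q'} {q} {p'} {p} sum q+1≡p = +-cancelʳ-≡ p q' (p' + 1) (begin
  q' + p       ≡⟨ cong (q' +_) q+1≡p ⟨
  q' + (q + 1) ≡⟨ +-assoc q' q 1 ⟨
  q' + q + 1   ≡⟨ cong (_+ 1) sum ⟩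
  p' + p + 1   ≡⟨ +-assoc p' p 1 ⟩
  p' + (p + 1) ≡⟨ cong (p' +_) (+-comm p 1) ⟩
  p' + (1 + p) ≡⟨ +-assoc p' 1 p ⟨
  p' + 1 + p   ∎)
  where open ≡-Reasoning

pell-norm : ∀ m → qpell (m * 2) * qpell (m * 2) ≡ 2 * (pell (m * 2) * pell (m * 2)) + 1
                × qpell (1 + m * 2) * qpell (1 + m * 2) + 1 ≡ 2 * (pell (1 + m * 2) * pell (1 + m * 2))
pell-norm zero = refl , refl
pell-norm (suc m) = even , sign-flip⁺ (qpell²+qpell²≡2pell²+2pell² (2 + m * 2)) even
  where
  even : qpell (2 + m * 2) * qpell (2 + m * 2) ≡ 2 * (pell (2 + m * 2) * pell (2 + m * 2)) + 1
  even = sign-flip⁻ (qpell²+qpell²≡2pell²+2pell² (1 + m * 2)) (proj₂ (pell-norm m))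

pell-norm-even : ∀ n → n % 2 ≡ 0 → qpell n * qpell n ≡ 2 * (pell n * pell n) + 1
pell-norm-even n n%2≡0 = n%2≡r-elim (λ n → qpell n * qpell n ≡ 2 * (pell n * pell n) + 1) {n}
                                   n%2≡0 (λ m → proj₁ (pell-norm m))

pell-norm-odd : ∀ n → n % 2 ≡ 1 → qpell n * qpell n + 1 ≡ 2 * (pell n * pell n)
pell-norm-odd n n%2≡1 = n%2≡r-elim (λ n → qpell n * qpell n + 1 ≡ 2 * (pell n * pell n)) {n}
                                  n%2≡1 (λ m → proj₂ (pell-norm m))

2∣pell[m*2] : ∀ m → 2 ∣ pell (m * 2)
2∣pell[m*2] zero = divides 0 refl
2∣pell[m*2] (suc m) = ∣m∣n⇒∣m+n (m∣m*n (pell (suc (m * 2)))) (2∣pell[m*2] m)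

2∣pell[1+odd] : ∀ n → n % 2 ≡ 1 → 2 ∣ pell (suc n)
2∣pell[1+odd] n n%2≡1 = n%2≡r-elim (λ n → 2 ∣ pell (suc n)) {n} n%2≡1 (λ m → 2∣pell[m*2] (suc m))

bal-recurrent : Recurrent 6 0 bal
bal-recurrent =
  SubtractiveRecurrence.recurrent {6} {0} {bal} (s≤s (s≤s z≤n)) z≤n (λ _ → sym (+-identityʳ _))

cob-recurrent : Recurrent 6 2 cob
cob-recurrent = SubtractiveRecurrence.recurrent {6} {2} {cob} (s≤s (s≤s z≤n)) z≤n (λ _ → refl)

pell*qpell-recurrent : Recurrent 6 0 (λ n → pell n * qpell n)
pell*qpell-recurrent n
  rewrite pell-suc (suc n) | qpell-suc (suc n) | pell-suc n | qpell-suc n = identity (pell n) (qpell n)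
  where
  identity : ∀ p q → ((p + q) + (q + 2 * p)) * ((q + 2 * p) + 2 * (p + q)) + p * q
                   ≡ 6 * ((p + q) * (q + 2 * p)) + 0
  identity = solve-∀

bal≡pell*qpell : ∀ n → bal n ≡ pell n * qpell n
bal≡pell*qpell = recurrent-unique {6} {0} {bal} bal-recurrent pell*qpell-recurrent refl refl

bal+2*cob+1≡bal : ∀ n → bal n + 2 * cob (suc n) + 1 ≡ bal (suc n)
bal+2*cob+1≡bal =
  recurrent-unique {6} {0} {g = λ n → bal (suc n)} recurrent (λ n → bal-recurrent (suc n)) refl refl
  where
  recurrent : Recurrent 6 0 (λ n → bal n + 2 * cob (suc n) + 1)
  recurrent n = begin
    (bal (2 + n) + 2 * cob (3 + n) + 1) + (bal n + 2 * cob (1 + n) + 1)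
      ≡⟨ regroup (bal n) (bal (2 + n)) (cob (1 + n)) (cob (3 + n)) ⟩
    (bal (2 + n) + bal n) + 2 * (cob (3 + n) + cob (1 + n)) + 2
      ≡⟨ cong₂ (λ u v → u + 2 * v + 2) (bal-recurrent n) (cob-recurrent (suc n)) ⟩
    (6 * bal (1 + n) + 0) + 2 * (6 * cob (2 + n) + 2) + 2
      ≡⟨ collect (bal (1 + n)) (cob (2 + n)) ⟩
    6 * (bal (1 + n) + 2 * cob (2 + n) + 1) + 0
      ∎
    where
    open ≡-Reasoning
    regroup : ∀ b₀ b₂ c₁ c₃ → (b₂ + 2 * c₃ + 1) + (b₀ + 2 * c₁ + 1)
                            ≡ (b₂ + b₀) + 2 * (c₃ + c₁) + 2
    regroup = solve-∀
    collect : ∀ b₁ c₂ → (6 * b₁ + 0) + 2 * (6 * c₂ + 2) + 2 ≡ 6 * (b₁ + 2 * c₂ + 1) + 0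
    collect = solve-∀

windowSum-recurrent : ∀ k → Recurrent 6 (2 * k) (windowSum k)
windowSum-recurrent zero n = refl
windowSum-recurrent (suc k) n = begin
  (windowSum k (2 + n) + cob (2 + m)) + (windowSum k n + cob m)
    ≡⟨ interchange (windowSum k (2 + n)) (cob (2 + m)) (windowSum k n) (cob m) ⟩
  (windowSum k (2 + n) + windowSum k n) + (cob (2 + m) + cob m)
    ≡⟨ cong₂ _+_ (windowSum-recurrent k n) (cob-recurrent m) ⟩
  (6 * windowSum k (1 + n) + 2 * k) + (6 * cob (1 + m) + 2)
    ≡⟨ collect (windowSum k (1 + n)) (cob (1 + m)) k ⟩
  6 * (windowSum k (1 + n) + cob (1 + m)) + 2 * suc k
    ∎
  where
  open ≡-Reasoning
  m : ℕ
  m = n + suc k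
  interchange : ∀ a b c d → (a + b) + (c + d) ≡ (a + c) + (b + d)
  interchange = solve-∀
  collect : ∀ w c k → (6 * w + 2 * k) + (6 * c + 2) ≡ 6 * (w + c) + 2 * (1 + k)
  collect = solve-∀

bal+2*windowSum+k≡bal : ∀ k n → bal n + 2 * windowSum k n + k ≡ bal (n + k)
bal+2*windowSum+k≡bal zero n =
  trans (+-identityʳ _) (trans (+-identityʳ _) (cong bal (sym (+-identityʳ n))))
bal+2*windowSum+k≡bal (suc k) n = begin
  bal n + 2 * (windowSum k n + cob (n + suc k)) + suc k
    ≡⟨ regroup (bal n) (windowSum k n) (cob (n + suc k)) k ⟩
  (bal n + 2 * windowSum k n + k) + 2 * cob (n + suc k) + 1
    ≡⟨ cong₂ (λ u m → u + 2 * cob m + 1) (bal+2*windowSum+k≡bal k n) (+-suc n k) ⟩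
  bal (n + k) + 2 * cob (suc (n + k)) + 1
    ≡⟨ bal+2*cob+1≡bal (n + k) ⟩
  bal (suc (n + k))
    ≡⟨ cong bal (+-suc n k) ⟨
  bal (n + suc k)
    ∎
  where
  open ≡-Reasoning
  regroup : ∀ b w c k → b + 2 * (w + c) + (1 + k) ≡ (b + 2 * w + k) + 2 * c + 1
  regroup = solve-∀

IsGcd₃ : ℕ → ℕ → ℕ → ℕ → Set
IsGcd₃ a b c d = (d ∣ a × d ∣ b × d ∣ c) × (∀ e → e ∣ a → e ∣ b → e ∣ c → e ∣ d)

isGcdOf-recurrent : ∀ {a c f d} → Recurrent a c f → IsGcd₃ (f 0) (f 1) c d → IsGcdOf f d
isGcdOf-recurrent {a} {c} {f} {d} rec ((d∣f₀ , d∣f₁ , d∣c) , greatest) =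
  (λ n → proj₁ (divides-consecutive n)) ,
  λ e e∣f → greatest e (e∣f 0) (e∣f 1)
    (∣m+n∣m⇒∣n (subst (e ∣_) (rec 0) (∣m∣n⇒∣m+n (e∣f 2) (e∣f 0))) (∣n⇒∣m*n a (e∣f 1)))
  where
  divides-consecutive : ∀ n → d ∣ f n × d ∣ f (1 + n)
  divides-consecutive zero = d∣f₀ , d∣f₁
  divides-consecutive (suc n) with divides-consecutive n
  ... | d∣fₙ , d∣fₙ₊₁ = d∣fₙ₊₁ , ∣m+n∣m⇒∣n d∣fₙ+fₙ₊₂ d∣fₙ
    where
    d∣fₙ+fₙ₊₂ : d ∣ f n + f (2 + n)
    d∣fₙ+fₙ₊₂ = subst (d ∣_) (trans (sym (rec n)) (+-comm (f (2 + n)) (f n)))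
                      (∣m∣n⇒∣m+n (∣n⇒∣m*n a d∣fₙ₊₁) d∣c)

∣x∧∣2k∧∣2x+[k+1]⇒∣2 : ∀ {d x k} → d ∣ x → d ∣ 2 * k → d ∣ 2 * x + (k + 1) → d ∣ 2
∣x∧∣2k∧∣2x+[k+1]⇒∣2 {d} {x} {k} d∣x d∣2k d∣2x+k+1 =
  ∣m+n∣m⇒∣n (subst (d ∣_) (*-distribˡ-+ 2 k 1) (∣n⇒∣m*n 2 d∣k+1)) d∣2k
  where
  d∣k+1 : d ∣ k + 1
  d∣k+1 = ∣m+n∣m⇒∣n d∣2x+k+1 (∣n⇒∣m*n 2 d∣x)

-- The identities below are proved by adding hypotheses to both sides until what
-- remains is a ring identity (and cancelling a factor 2 where needed).
isGcd₃-even : ∀ {x y k P Q} → 2 * x + k ≡ P * Q → 1 + 2 * y + k ≡ (P + Q) * (Q + 2 * P) →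
              Q * Q ≡ 2 * (P * P) + 1 → IsGcd₃ x y (2 * k) (gcd x P)
isGcd₃-even {x} {y} {k} {P} {Q} 2x+k≡PQ 1+2y+k≡P′Q′ norm = (t∣x , t∣y , t∣2k) , greatest
  where
  w : ℕ
  w = 2 * P + Q

  y≡x+P*w : y ≡ x + P * w
  y≡x+P*w = *-cancelˡ-≡ y (x + P * w) 2 (+-cancelʳ-≡-by
    (cong₂ _+_ (cong₂ _+_ (sym 1+2y+k≡P′Q′) 2x+k≡PQ) (sym norm)) (identity x y k P Q))
    where
    identity : ∀ x y k P Q → 2 * y + ((P + Q) * (Q + 2 * P) + (2 * x + k) + (2 * (P * P) + 1))
                           ≡ 2 * (x + P * (2 * P + Q)) + ((1 + 2 * y + k) + P * Q + Q * Q)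
    identity = solve-∀

  Q*w≡P*w+[2x+k+1] : Q * w ≡ P * w + (2 * x + (k + 1))
  Q*w≡P*w+[2x+k+1] = +-cancelʳ-≡-by (cong₂ _+_ (sym norm) 2x+k≡PQ) (identity x k P Q)
    where
    identity : ∀ x k P Q → Q * (2 * P + Q) + ((2 * (P * P) + 1) + (2 * x + k))
                         ≡ P * (2 * P + Q) + (2 * x + (k + 1)) + (Q * Q + P * Q)
    identity = solve-∀

  Q*w≡2[PQ+PP]+1 : Q * w ≡ 2 * (P * Q + P * P) + 1
  Q*w≡2[PQ+PP]+1 = +-cancelʳ-≡-by (sym norm) (identity P Q)
    where
    identity : ∀ P Q → Q * (2 * P + Q) + (2 * (P * P) + 1) ≡ 2 * (P * Q + P * P) + 1 + Q * Q
    identity = solve-∀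

  t∣x : gcd x P ∣ x
  t∣x = gcd[m,n]∣m x P
  t∣P : gcd x P ∣ P
  t∣P = gcd[m,n]∣n x P
  t∣y : gcd x P ∣ y
  t∣y = subst (gcd x P ∣_) (sym y≡x+P*w) (∣m∣n⇒∣m+n t∣x (∣m⇒∣m*n w t∣P))
  t∣2k : gcd x P ∣ 2 * k
  t∣2k = ∣n⇒∣m*n 2
    (∣m+n∣m⇒∣n (subst (gcd x P ∣_) (sym 2x+k≡PQ) (∣m⇒∣m*n Q t∣P)) (∣n⇒∣m*n 2 t∣x))

  gcd[e,w]∣1 : ∀ {e} → e ∣ x → e ∣ 2 * k → gcd e w ∣ 1
  gcd[e,w]∣1 {e} e∣x e∣2k =
    ∣m+n∣m⇒∣n (subst (g ∣_) Q*w≡2[PQ+PP]+1 g∣Q*w) (∣m⇒∣m*n (P * Q + P * P) g∣2)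
    where
    g : ℕ
    g = gcd e w
    g∣Q*w : g ∣ Q * w
    g∣Q*w = ∣n⇒∣m*n Q (gcd[m,n]∣n e w)
    g∣2 : g ∣ 2
    g∣2 = ∣x∧∣2k∧∣2x+[k+1]⇒∣2 (∣-trans (gcd[m,n]∣m e w) e∣x) (∣-trans (gcd[m,n]∣m e w) e∣2k)
      (∣m+n∣m⇒∣n (subst (g ∣_) Q*w≡P*w+[2x+k+1] g∣Q*w) (∣n⇒∣m*n P (gcd[m,n]∣n e w)))

  greatest : ∀ e → e ∣ x → e ∣ y → e ∣ 2 * k → e ∣ gcd x P
  greatest e e∣x e∣y e∣2k =
    gcd-greatest e∣x (subst (e ∣_) (trans (cong (P *_) gcd≡1) (*-identityʳ P)) e∣P*gcd)
    where
    e∣P*gcd : e ∣ P * gcd e w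
    e∣P*gcd = ∣m*n⇒∣m*gcd[d,n] P (∣m+n∣m⇒∣n (subst (e ∣_) y≡x+P*w e∣y) e∣x)
    gcd≡1 : gcd e w ≡ 1
    gcd≡1 = ∣1⇒≡1 (gcd[e,w]∣1 e∣x e∣2k)

isGcd₃-odd : ∀ {x y k P Q} → 2 * x + k ≡ P * Q → 1 + 2 * y + k ≡ (P + Q) * (Q + 2 * P) →
             Q * Q + 1 ≡ 2 * (P * P) → 2 ∣ P + Q → IsGcd₃ x y (2 * k) (gcd x (2 * Q))
isGcd₃-odd {x} {y} {k} {P} {Q} 2x+k≡PQ 1+2y+k≡P′Q′ norm 2∣u = (t∣x , t∣y , t∣2k) , greatest
  where
  u : ℕ
  u = P + Q

  y≡x+Q*u : y ≡ x + Q * u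
  y≡x+Q*u = *-cancelˡ-≡ y (x + Q * u) 2 (+-cancelʳ-≡-by
    (cong₂ _+_ (cong₂ _+_ (sym 1+2y+k≡P′Q′) 2x+k≡PQ) norm) (identity x y k P Q))
    where
    identity : ∀ x y k P Q → 2 * y + ((P + Q) * (Q + 2 * P) + (2 * x + k) + (Q * Q + 1))
                           ≡ 2 * (x + Q * (P + Q)) + ((1 + 2 * y + k) + P * Q + 2 * (P * P))
    identity = solve-∀

  2P*u≡Q*u+[2x+k+1] : 2 * P * u ≡ Q * u + (2 * x + (k + 1))
  2P*u≡Q*u+[2x+k+1] = +-cancelʳ-≡-by (cong₂ _+_ norm 2x+k≡PQ) (identity x k P Q)
    where
    identity : ∀ x k P Q → 2 * P * (P + Q) + ((Q * Q + 1) + (2 * x + k))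
                         ≡ Q * (P + Q) + (2 * x + (k + 1)) + (2 * (P * P) + P * Q)
    identity = solve-∀

  2Q*P≡2[2x]+2k : 2 * Q * P ≡ 2 * (2 * x) + 2 * k
  2Q*P≡2[2x]+2k = begin
    2 * Q * P       ≡⟨ *-assoc 2 Q P ⟩
    2 * (Q * P)     ≡⟨ cong (2 *_) (*-comm Q P) ⟩
    2 * (P * Q)     ≡⟨ cong (2 *_) 2x+k≡PQ ⟨
    2 * (2 * x + k) ≡⟨ *-distribˡ-+ 2 (2 * x) k ⟩
    2 * (2 * x) + 2 * k ∎
    where open ≡-Reasoning

  t∣x : gcd x (2 * Q) ∣ x
  t∣x = gcd[m,n]∣m x (2 * Q)
  t∣2Q : gcd x (2 * Q) ∣ 2 * Q
  t∣2Q = gcd[m,n]∣n x (2 * Q)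
  t∣y : gcd x (2 * Q) ∣ y
  t∣y = subst (gcd x (2 * Q) ∣_) (sym y≡x+Q*u)
    (∣m∣n⇒∣m+n t∣x (∣-trans t∣2Q (subst (_∣ Q * u) (*-comm Q 2) (*-monoʳ-∣ Q 2∣u))))
  t∣2k : gcd x (2 * Q) ∣ 2 * k
  t∣2k = ∣m+n∣m⇒∣n (subst (gcd x (2 * Q) ∣_) 2Q*P≡2[2x]+2k (∣m⇒∣m*n P t∣2Q))
                   (∣n⇒∣m*n 2 (∣n⇒∣m*n 2 t∣x))

  gcd[e,u]∣2 : ∀ {e} → e ∣ x → e ∣ 2 * k → gcd e u ∣ 2
  gcd[e,u]∣2 {e} e∣x e∣2k = ∣x∧∣2k∧∣2x+[k+1]⇒∣2 (∣-trans g∣e e∣x) (∣-trans g∣e e∣2k)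
    (∣m+n∣m⇒∣n (subst (g ∣_) 2P*u≡Q*u+[2x+k+1] (∣n⇒∣m*n (2 * P) g∣u)) (∣n⇒∣m*n Q g∣u))
    where
    g : ℕ
    g = gcd e u
    g∣e : g ∣ e
    g∣e = gcd[m,n]∣m e u
    g∣u : g ∣ u
    g∣u = gcd[m,n]∣n e u

  greatest : ∀ e → e ∣ x → e ∣ y → e ∣ 2 * k → e ∣ gcd x (2 * Q)
  greatest e e∣x e∣y e∣2k =
    gcd-greatest e∣x (subst (e ∣_) (*-comm Q 2) (∣-trans e∣Q*gcd Q*gcd∣Q*2))
    where
    e∣Q*gcd : e ∣ Q * gcd e u
    e∣Q*gcd = ∣m*n⇒∣m*gcd[d,n] Q (∣m+n∣m⇒∣n (subst (e ∣_) y≡x+Q*u e∣y) e∣x)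
    Q*gcd∣Q*2 : Q * gcd e u ∣ Q * 2
    Q*gcd∣Q*2 = *-monoʳ-∣ Q (gcd[e,u]∣2 e∣x e∣2k)

theorem23 : ∀ (k : ℕ) → 1 ≤ k →
    (k % 2 ≡ 0 → IsGcdOf (windowSum k) (gcd ((bal k ∸ k) / 2) (pell k)))
    × (k % 2 ≡ 1 → IsGcdOf (windowSum k) (gcd ((bal k ∸ k) / 2) (2 * qpell k)))
theorem23 k _ = even , odd
  where
  2x+k≡bal : 2 * windowSum k 0 + k ≡ bal k
  2x+k≡bal = bal+2*windowSum+k≡bal k 0

  [bal∸k]/2≡x : (bal k ∸ k) / 2 ≡ windowSum k 0
  [bal∸k]/2≡x = [m∸n]/2≡x 2x+k≡bal

  2x+k≡PQ : 2 * windowSum k 0 + k ≡ pell k * qpell k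
  2x+k≡PQ = trans 2x+k≡bal (bal≡pell*qpell k)

  1+2y+k≡P′Q′ : 1 + 2 * windowSum k 1 + k ≡ (pell k + qpell k) * (qpell k + 2 * pell k)
  1+2y+k≡P′Q′ = trans (bal+2*windowSum+k≡bal k 1)
              (trans (bal≡pell*qpell (suc k)) (cong₂ _*_ (pell-suc k) (qpell-suc k)))

  isGcdOf-windowSum : ∀ {d} → IsGcd₃ (windowSum k 0) (windowSum k 1) (2 * k) d → IsGcdOf (windowSum k) d
  isGcdOf-windowSum = isGcdOf-recurrent {6} (windowSum-recurrent k)

  even : k % 2 ≡ 0 → IsGcdOf (windowSum k) (gcd ((bal k ∸ k) / 2) (pell k))
  even k%2≡0 = subst (λ x → IsGcdOf (windowSum k) (gcd x (pell k))) (sym [bal∸k]/2≡x)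
    (isGcdOf-windowSum (isGcd₃-even {P = pell k} {Q = qpell k} 2x+k≡PQ 1+2y+k≡P′Q′
                                    (pell-norm-even k k%2≡0)))

  odd : k % 2 ≡ 1 → IsGcdOf (windowSum k) (gcd ((bal k ∸ k) / 2) (2 * qpell k))
  odd k%2≡1 = subst (λ x → IsGcdOf (windowSum k) (gcd x (2 * qpell k))) (sym [bal∸k]/2≡x)
    (isGcdOf-windowSum (isGcd₃-odd {P = pell k} {Q = qpell k} 2x+k≡PQ 1+2y+k≡P′Q′
                                   (pell-norm-odd k k%2≡1)
                                   (subst (2 ∣_) (pell-suc k) (2∣pell[1+odd] k k%2≡1))))
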